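{- Let $n\ge3$ and let $M_n$ be the matching complex, i.e. the simplicial complex on vertex set $V=\binom{[n]}{2}$ whose faces are the sets of pairwise disjoint edges of the complete graph on $[n]$. Then $M_n=(\Delta_n^{n-2})^\ast$, i.e. $M_n$ is the Alexander dual of $\Delta_n^{n-2}$. In particular, $\widetilde H_i(M_n)\cong\widetilde H^{\binom n2-i-3}(\Delta_n^{n-2})$ for all $i$.
   Context: For $0<i<n$, a graph on $[n]$ is $i$-connected if deleting any $j<i$ of its vertices leaves a connected graph. $\Delta_n^{i}$ is the simplicial complex on vertex set $\binom{[n]}{2}$ whose faces are the edge sets of not $i$-connected graphs on $[n]$. For a simplicial complex $\Delta$ on vertex set $V$, its Alexander dual is $\Delta^\ast=\{B\subseteq V: V\setminus B\notin\Delta\}$. (Co)homology is reduced with integer coefficients. -}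

module Defs where

open import Data.Nat using (ℕ; _<_)
open import Data.Bool using (Bool; true; not)
open import Data.Fin as F using (Fin)
open import Data.Fin.Subset using (Subset; _∉_; ∣_∣)
open import Data.Product using (Σ; _×_; proj₁; proj₂)
open import Data.Sum using (_⊎_)
open import Relation.Nullary using (¬_)
open import Relation.Binary.PropositionalEquality using (_≡_)

Edge : ℕ → Set
Edge n = Σ (Fin n) λ i → Σ (Fin n) λ j → i F.< j

src : ∀ {n} → Edge n → Fin n
src e = proj₁ e

tgt : ∀ {n} → Edge n → Fin n
tgt e = proj₁ (proj₂ e)

-- A subset of the vertex set binom([n],2) of the complexes, i.e. an edge
-- set, i.e. a (simple) graph on [n].
EdgeSet : ℕ → Set
EdgeSet n = Edge n → Bool

complement : ∀ {n} → EdgeSet n → EdgeSet n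
complement B e = not (B e)

Complex : ℕ → Set₁
Complex n = EdgeSet n → Set

AlexanderDual : ∀ {n} → Complex n → Complex n
AlexanderDual Δ B = ¬ Δ (complement B)

ShareVertex : ∀ {n} → Edge n → Edge n → Set
ShareVertex e e' =
  (src e ≡ src e') ⊎ (src e ≡ tgt e') ⊎ (tgt e ≡ src e') ⊎ (tgt e ≡ tgt e')

-- Matching complex M_n: sets of pairwise disjoint edges
-- (two distinct edges of B never share an endpoint).
MatchingComplex : (n : ℕ) → Complex n
MatchingComplex n B =
  ∀ (e e' : Edge n) → B e ≡ true → B e' ≡ true → ShareVertex e e' →
  (src e ≡ src e') × (tgt e ≡ tgt e')

Adj : ∀ {n} → EdgeSet n → Fin n → Fin n → Set
Adj {n} G u v = Σ (Edge n) λ e → (G e ≡ true) ×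
  (((src e ≡ u) × (tgt e ≡ v)) ⊎ ((src e ≡ v) × (tgt e ≡ u)))

-- Reachability in G - S (the graph with vertex set S deleted).
data Reach {n} (G : EdgeSet n) (S : Subset n) (u : Fin n) : Fin n → Set where
  here : u ∉ S → Reach G S u u
  step : ∀ {w v} → Reach G S u w → Adj G w v → v ∉ S → Reach G S u v

ConnectedAfterDeleting : ∀ {n} → EdgeSet n → Subset n → Set
ConnectedAfterDeleting G S = ∀ u v → u ∉ S → v ∉ S → Reach G S u v

IConnected : ∀ {n} → ℕ → EdgeSet n → Set
IConnected {n} i G = ∀ (S : Subset n) → ∣ S ∣ < i → ConnectedAfterDeleting G S

-- Δ_n^i: faces are edge sets of graphs that are not i-connected.
NotIConnectedComplex : (n i : ℕ) → Complex n
NotIConnectedComplex n i G = ¬ IConnected i G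

-- Unfolding the Alexander dual, B must be a matching exactly when the complement
-- graph K_n ∖ B is (n − 2)-connected. If B is a matching, any two vertices u, v of
-- K_n ∖ B are adjacent or, when uv ∈ B, joined through any third vertex w, since B
-- contains neither uw nor wv; deleting fewer than n − 2 vertices always spares such
-- a w. If B is not a matching, it contains edges ab and ac with b ≠ c; deleting the
-- n − 3 vertices other than a, b, c isolates a in K_n ∖ B.
module Submission where

open import Defs
open import Data.Nat using (ℕ; _≤_; _∸_)
open import Data.Product using (_×_)

open import Data.Bool using (true; false; not)
open import Data.Bool.Properties using (not-¬)
open import Data.Empty using (⊥-elim)
open import Data.Fin as F using (Fin; zero; suc; _≟_)
open import Data.Fin.Properties using (<-irrelevant; <-cmp; <-asym; <⇒≢)
open import Data.Fin.Subset
  using (Subset; _∈_; _∉_; _∪_; _-_; ⁅_⁆; ∁; ∣_∣; inside; outside)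
open import Data.Fin.Subset.Properties
open import Data.Vec using ([]; _∷_)
open import Data.Nat using (suc; s≤s; z≤n; _+_; _<_)
open import Data.Nat.Properties
  using (≤-trans; ≤-<-trans; ≤-reflexive; n≤1+n; +-suc; +-comm; +-monoʳ-≤; ∸-monoʳ-≤; module ≤-Reasoning)
open import Data.Product using (Σ; ∃; ∃-syntax; _,_; <_,_>; proj₁; proj₂)
open import Data.Sum using (_⊎_; inj₁; inj₂)
open import Function using (_∘_)
open import Relation.Binary using (tri<; tri≈; tri>)
open import Relation.Binary.PropositionalEquality
open import Relation.Nullary using (¬_; yes; no; contradiction)
open import Relation.Nullary.Decidable using (_×-dec_; decidable-stable)

private
  variable
    n : ℕ
    x y z : Fin n
    e e' : Edge n
    G : EdgeSet n

src<tgt : (e : Edge n) → src e F.< tgt e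
src<tgt e = proj₂ (proj₂ e)

Edge-≡ : src e ≡ src e' → tgt e ≡ tgt e' → e ≡ e'
Edge-≡ {e = i , j , p} {e' = .i , .j , q} refl refl = cong (λ r → i , j , r) (<-irrelevant p q)

-- The endpoint clause of Adj, so that Adj G x y unfolds to Σ e (G e ≡ true × Joins e x y).
-- Being a definition, Joins e x y does not determine e, which must then be supplied explicitly.
Joins : Edge n → Fin n → Fin n → Set
Joins e x y = ((src e ≡ x) × (tgt e ≡ y)) ⊎ ((src e ≡ y) × (tgt e ≡ x))

Joins-sym : Joins e x y → Joins e y x
Joins-sym (inj₁ ends) = inj₂ ends
Joins-sym (inj₂ ends) = inj₁ ends

Joins⇒≢ : Joins e x y → x ≢ y
Joins⇒≢ {e = e} (inj₁ (refl , refl)) = <⇒≢ (src<tgt e)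
Joins⇒≢ {e = e} (inj₂ (refl , refl)) = <⇒≢ (src<tgt e) ∘ sym

Joins-unique : Joins e x y → Joins e' x y → e ≡ e'
Joins-unique (inj₁ (refl , refl)) (inj₁ (s , t)) = Edge-≡ (sym s) (sym t)
Joins-unique (inj₂ (refl , refl)) (inj₂ (s , t)) = Edge-≡ (sym s) (sym t)
Joins-unique {e = e} {e' = e'} (inj₁ (refl , refl)) (inj₂ (refl , t)) =
  ⊥-elim (<-asym (src<tgt e) (subst (_ F.<_) t (src<tgt e')))
Joins-unique {e = e} {e' = e'} (inj₂ (refl , refl)) (inj₁ (refl , t)) =
  ⊥-elim (<-asym (src<tgt e) (subst (_ F.<_) t (src<tgt e')))

Joins-functional : Joins e x y → Joins e x z → y ≡ z
Joins-functional (inj₁ (refl , refl)) (inj₁ (_ , refl)) = refl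
Joins-functional (inj₂ (refl , refl)) (inj₂ (refl , _)) = refl
Joins-functional {e = e} (inj₁ (refl , refl)) (inj₂ (_ , t)) = contradiction (sym t) (<⇒≢ (src<tgt e))
Joins-functional {e = e} (inj₂ (refl , refl)) (inj₁ (s , _)) = contradiction s (<⇒≢ (src<tgt e))

joining : x ≢ y → Σ (Edge n) λ e → Joins e x y
joining {x = x} {y = y} x≢y with <-cmp x y
... | tri< x<y _ _ = (x , y , x<y) , inj₁ (refl , refl)
... | tri≈ _ x≡y _ = contradiction x≡y x≢y
... | tri> _ _ y<x = (y , x , y<x) , inj₂ (refl , refl)

Joins⇒ShareVertex : Joins e x y → Joins e' x z → ShareVertex e e'
Joins⇒ShareVertex (inj₁ (s , _)) (inj₁ (s' , _)) = inj₁ (trans s (sym s'))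
Joins⇒ShareVertex (inj₁ (s , _)) (inj₂ (_ , t')) = inj₂ (inj₁ (trans s (sym t')))
Joins⇒ShareVertex (inj₂ (_ , t)) (inj₁ (s' , _)) = inj₂ (inj₂ (inj₁ (trans t (sym s'))))
Joins⇒ShareVertex (inj₂ (_ , t)) (inj₂ (_ , t')) = inj₂ (inj₂ (inj₂ (trans t (sym t'))))

ShareVertex⇒common-endpoint : ShareVertex e e' → ∃[ a ] ∃[ b ] ∃[ c ] Joins e a b × Joins e' a c
ShareVertex⇒common-endpoint (inj₁ s≡s') = _ , _ , _ , inj₁ (refl , refl) , inj₁ (sym s≡s' , refl)
ShareVertex⇒common-endpoint (inj₂ (inj₁ s≡t')) = _ , _ , _ , inj₁ (refl , refl) , inj₂ (refl , sym s≡t')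
ShareVertex⇒common-endpoint (inj₂ (inj₂ (inj₁ t≡s'))) = _ , _ , _ , inj₂ (refl , refl) , inj₁ (sym t≡s' , refl)
ShareVertex⇒common-endpoint (inj₂ (inj₂ (inj₂ t≡t'))) = _ , _ , _ , inj₂ (refl , refl) , inj₂ (refl , sym t≡t')

Adj-sym : Adj G x y → Adj G y x
Adj-sym (e , Ge , j) = e , Ge , Joins-sym {e = e} j

¬Adj-loop : ¬ Adj G x x
¬Adj-loop (e , _ , j) = Joins⇒≢ {e = e} j refl

Adj⊎Adj-complement : x ≢ y → Adj G x y ⊎ Adj (complement G) x y
Adj⊎Adj-complement {G = G} x≢y with joining x≢y
... | e , j with G e in Ge
...   | true  = inj₁ (e , Ge , j)
...   | false = inj₂ (e , cong not Ge , j)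

Adj⇒¬Adj-complement : Adj G x y → ¬ Adj (complement G) x y
Adj⇒¬Adj-complement {G = G} (e , Ge , j) (e' , G'e' , j') =
  not-¬ (sym Ge) (sym (subst (λ f → not (G f) ≡ true) (Joins-unique j' j) G'e'))

matching-partner-unique : ∀ {B : EdgeSet n} → MatchingComplex n B → Adj B x y → Adj B x z → y ≡ z
matching-partner-unique {x = x} {z = z} matching (e , Be , j) (e' , Be' , j')
  with s≡s' , t≡t' ← matching e e' Be Be' (Joins⇒ShareVertex {e = e} {e' = e'} j j')
  = Joins-functional {e = e} j (subst (λ f → Joins f x z) (sym (Edge-≡ {e = e} {e' = e'} s≡s' t≡t')) j')

matching-complement-adj : ∀ {B : EdgeSet n} → MatchingComplex n B →
  Adj B x y → x ≢ z → y ≢ z → Adj (complement B) x z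
matching-complement-adj matching xy x≢z y≢z with Adj⊎Adj-complement x≢z
... | inj₁ xz = contradiction (matching-partner-unique matching xy xz) y≢z
... | inj₂ xz = xz

x∈p⇒x∈p∪q∪r : ∀ {p q r : Subset n} → x ∈ p → x ∈ p ∪ q ∪ r
x∈p⇒x∈p∪q∪r = x∈p∪q⁺ ∘ inj₁

x∈q⇒x∈p∪q∪r : ∀ {p q r : Subset n} → x ∈ q → x ∈ p ∪ q ∪ r
x∈q⇒x∈p∪q∪r = x∈p∪q⁺ ∘ inj₂ ∘ x∈p∪q⁺ ∘ inj₁

x∈r⇒x∈p∪q∪r : ∀ {p q r : Subset n} → x ∈ r → x ∈ p ∪ q ∪ r
x∈r⇒x∈p∪q∪r = x∈p∪q⁺ ∘ inj₂ ∘ x∈p∪q⁺ ∘ inj₂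

∣p∪q∣≤∣p∣+∣q∣ : (p q : Subset n) → ∣ p ∪ q ∣ ≤ ∣ p ∣ + ∣ q ∣
∣p∪q∣≤∣p∣+∣q∣ [] [] = z≤n
∣p∪q∣≤∣p∣+∣q∣ (inside ∷ p) (inside ∷ q) =
  s≤s (≤-trans (∣p∪q∣≤∣p∣+∣q∣ p q) (+-monoʳ-≤ ∣ p ∣ (n≤1+n ∣ q ∣)))
∣p∪q∣≤∣p∣+∣q∣ (inside ∷ p) (outside ∷ q) = s≤s (∣p∪q∣≤∣p∣+∣q∣ p q)
∣p∪q∣≤∣p∣+∣q∣ (outside ∷ p) (inside ∷ q) =
  ≤-trans (s≤s (∣p∪q∣≤∣p∣+∣q∣ p q)) (≤-reflexive (sym (+-suc ∣ p ∣ ∣ q ∣)))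
∣p∪q∣≤∣p∣+∣q∣ (outside ∷ p) (outside ∷ q) = ∣p∪q∣≤∣p∣+∣q∣ p q

∣p∣<n⇒∃∉ : (p : Subset n) → ∣ p ∣ < n → ∃ λ x → x ∉ p
∣p∣<n⇒∃∉ (outside ∷ p) _ = zero , λ ()
∣p∣<n⇒∃∉ (inside ∷ p) (s≤s ∣p∣<n) with x , x∉p ← ∣p∣<n⇒∃∉ p ∣p∣<n = suc x , x∉p ∘ drop-there

∣p∪⁅x⁆∪⁅y⁆∣≤2+∣p∣ : (p : Subset n) (x y : Fin n) → ∣ p ∪ ⁅ x ⁆ ∪ ⁅ y ⁆ ∣ ≤ 2 + ∣ p ∣
∣p∪⁅x⁆∪⁅y⁆∣≤2+∣p∣ p x y = begin
  ∣ p ∪ ⁅ x ⁆ ∪ ⁅ y ⁆ ∣          ≤⟨ ∣p∪q∣≤∣p∣+∣q∣ p _ ⟩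
  ∣ p ∣ + ∣ ⁅ x ⁆ ∪ ⁅ y ⁆ ∣      ≤⟨ +-monoʳ-≤ ∣ p ∣ (∣p∪q∣≤∣p∣+∣q∣ ⁅ x ⁆ ⁅ y ⁆) ⟩
  ∣ p ∣ + (∣ ⁅ x ⁆ ∣ + ∣ ⁅ y ⁆ ∣) ≡⟨ cong₂ (λ a b → ∣ p ∣ + (a + b)) (∣⁅x⁆∣≡1 x) (∣⁅x⁆∣≡1 y) ⟩
  ∣ p ∣ + 2                      ≡⟨ +-comm ∣ p ∣ 2 ⟩
  2 + ∣ p ∣                      ∎
  where open ≤-Reasoning

fresh-vertex : (S : Subset n) (u v : Fin n) → ∣ S ∣ < n ∸ 2 → ∃ λ w → w ∉ S × u ≢ w × v ≢ w
fresh-vertex {n = suc (suc k)} S u v ∣S∣<k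
  with w , w∉ ← ∣p∣<n⇒∃∉ (S ∪ ⁅ u ⁆ ∪ ⁅ v ⁆) (≤-<-trans (∣p∪⁅x⁆∪⁅y⁆∣≤2+∣p∣ S u v) (s≤s (s≤s ∣S∣<k))) =
  w , w∉ ∘ x∈p⇒x∈p∪q∪r , (λ { refl → w∉ (x∈q⇒x∈p∪q∪r (x∈⁅x⁆ u)) }) , (λ { refl → w∉ (x∈r⇒x∈p∪q∪r (x∈⁅x⁆ v)) })

3≤∣⁅x⁆∪⁅y⁆∪⁅z⁆∣ : x ≢ y → x ≢ z → y ≢ z → 3 ≤ ∣ ⁅ x ⁆ ∪ ⁅ y ⁆ ∪ ⁅ z ⁆ ∣
3≤∣⁅x⁆∪⁅y⁆∪⁅z⁆∣ {x = x} {y = y} {z = z} x≢y x≢z y≢z = begin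
  3                  ≤⟨ s≤s (s≤s (≤-trans (s≤s z≤n) (x∈p⇒∣p-x∣<∣p∣ z∈T-x-y))) ⟩
  suc (suc ∣ T - x - y ∣) ≤⟨ s≤s (x∈p⇒∣p-x∣<∣p∣ y∈T-x) ⟩
  suc ∣ T - x ∣      ≤⟨ x∈p⇒∣p-x∣<∣p∣ x∈T ⟩
  ∣ T ∣              ∎
  where
  open ≤-Reasoning
  T : Subset _
  T = ⁅ x ⁆ ∪ ⁅ y ⁆ ∪ ⁅ z ⁆
  x∈T : x ∈ T
  x∈T = x∈p⇒x∈p∪q∪r (x∈⁅x⁆ x)
  y∈T-x : y ∈ T - x
  y∈T-x = x∈p∧x≢y⇒x∈p-y (x∈q⇒x∈p∪q∪r (x∈⁅x⁆ y)) (x≢y ∘ sym)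
  z∈T-x-y : z ∈ T - x - y
  z∈T-x-y = x∈p∧x≢y⇒x∈p-y (x∈p∧x≢y⇒x∈p-y (x∈r⇒x∈p∪q∪r (x∈⁅x⁆ z)) (x≢z ∘ sym)) (y≢z ∘ sym)

∈⁅x⁆∪⁅y⁆∪⁅z⁆⁻ : ∀ {v} → v ∈ ⁅ x ⁆ ∪ ⁅ y ⁆ ∪ ⁅ z ⁆ → v ≡ x ⊎ v ≡ y ⊎ v ≡ z
∈⁅x⁆∪⁅y⁆∪⁅z⁆⁻ {x = x} {y = y} {z = z} v∈ with x∈p∪q⁻ ⁅ x ⁆ _ v∈
... | inj₁ v∈x = inj₁ (x∈⁅y⁆⇒x≡y x v∈x)
... | inj₂ v∈yz with x∈p∪q⁻ ⁅ y ⁆ ⁅ z ⁆ v∈yz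
...   | inj₁ v∈y = inj₂ (inj₁ (x∈⁅y⁆⇒x≡y y v∈y))
...   | inj₂ v∈z = inj₂ (inj₂ (x∈⁅y⁆⇒x≡y z v∈z))

Reach-from-isolated : ∀ {S : Subset n} {a v} → (∀ {w} → w ∉ S → ¬ Adj G a w) → Reach G S a v → v ≡ a
Reach-from-isolated isolated (here _) = refl
Reach-from-isolated isolated (step r wv v∉S) with refl ← Reach-from-isolated isolated r =
  contradiction wv (isolated v∉S)

matching⇒complement-connected : ∀ {B : EdgeSet n} → MatchingComplex n B → IConnected (n ∸ 2) (complement B)
matching⇒complement-connected {B = B} matching S ∣S∣<n∸2 u v u∉S v∉S with u ≟ v
... | yes refl = here u∉S
... | no u≢v with Adj⊎Adj-complement u≢v
...   | inj₂ uv = step (here u∉S) uv v∉S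
...   | inj₁ uv∈B with w , w∉S , u≢w , v≢w ← fresh-vertex S u v ∣S∣<n∸2 =
  step (step (here u∉S) uw w∉S) (Adj-sym vw) v∉S
  where
  uw : Adj (complement B) u w
  uw = matching-complement-adj matching uv∈B u≢w v≢w
  vw : Adj (complement B) v w
  vw = matching-complement-adj matching (Adj-sym uv∈B) v≢w u≢w

cherry⇒¬IConnected : ∀ {B : EdgeSet n} {a b c} → 3 ≤ n →
  Adj B a b → Adj B a c → b ≢ c → ¬ IConnected (n ∸ 2) (complement B)
cherry⇒¬IConnected {n = suc (suc (suc k))} {B = B} {a} {b} {c} (s≤s (s≤s (s≤s _))) ab ac b≢c connected =
  contradiction (Reach-from-isolated isolated a⇝b) (a≢b ∘ sym)
  where
  a≢b : a ≢ b
  a≢b = Joins⇒≢ {e = proj₁ ab} (proj₂ (proj₂ ab))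
  a≢c : a ≢ c
  a≢c = Joins⇒≢ {e = proj₁ ac} (proj₂ (proj₂ ac))
  T S : Subset _
  T = ⁅ a ⁆ ∪ ⁅ b ⁆ ∪ ⁅ c ⁆
  S = ∁ T
  ∣S∣<n∸2 : ∣ S ∣ < suc k
  ∣S∣<n∸2 = s≤s (≤-trans (≤-reflexive (∣∁p∣≡n∸∣p∣ T)) (∸-monoʳ-≤ _ (3≤∣⁅x⁆∪⁅y⁆∪⁅z⁆∣ a≢b a≢c b≢c)))
  a⇝b : Reach (complement B) S a b
  a⇝b = connected S ∣S∣<n∸2 a b (x∈p⇒x∉∁p (x∈p⇒x∈p∪q∪r (x∈⁅x⁆ a))) (x∈p⇒x∉∁p (x∈q⇒x∈p∪q∪r (x∈⁅x⁆ b)))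
  isolated : ∀ {w} → w ∉ S → ¬ Adj (complement B) a w
  isolated w∉S with ∈⁅x⁆∪⁅y⁆∪⁅z⁆⁻ (x∉∁p⇒x∈p w∉S)
  ... | inj₁ refl = ¬Adj-loop
  ... | inj₂ (inj₁ refl) = Adj⇒¬Adj-complement ab
  ... | inj₂ (inj₂ refl) = Adj⇒¬Adj-complement ac

complement-connected⇒matching : ∀ {B : EdgeSet n} → 3 ≤ n →
  ¬ ¬ IConnected (n ∸ 2) (complement B) → MatchingComplex n B
complement-connected⇒matching {B = B} 3≤n ¬¬connected e e' Be Be' shared
  with a , b , c , j , j' ← ShareVertex⇒common-endpoint {e = e} {e' = e'} shared =
  decidable-stable (src e ≟ src e' ×-dec tgt e ≟ tgt e') λ different →
    ¬¬connected (cherry⇒¬IConnected {B = B} 3≤n (e , Be , j) (e' , Be' , j')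
      λ { refl → different (< cong src , cong tgt > (Joins-unique {e = e} {e' = e'} j j')) })

proposition7p1 : ∀ (n : ℕ) → 3 ≤ n → ∀ (B : EdgeSet n) →
    (MatchingComplex n B → AlexanderDual (NotIConnectedComplex n (n ∸ 2)) B) ×
    (AlexanderDual (NotIConnectedComplex n (n ∸ 2)) B → MatchingComplex n B)
proposition7p1 n 3≤n B =
  (λ matching notConnected → notConnected (matching⇒complement-connected matching)) ,
  complement-connected⇒matching 3≤n
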